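{- Let $G=(V,E)$ be a graph with vertex costs $c\ge 0$ and vertex prizes $\pi\ge0$, let $r\in V$ and $B>0$ be such that the graph is $B$-proper for $r$, and let $\epsilon\in(0,1]$. Let $T$ be a tree in $G$ containing $r$ with prize-to-cost ratio $\gamma$ and with $c(T)\ge \frac{\epsilon B}{2}$. Then one can find a tree $T^*$ in $G$ containing $r$ whose prize-to-cost ratio is at least $\frac{\epsilon}{4}\gamma$ and such that $\frac{\epsilon}{2}B\le c(T^*)\le(1+\epsilon)B$.
   Context: For a set of vertices (or subgraph) $U$, $c(U)$ and $\pi(U)$ are the total cost and prize of its vertices; the prize-to-cost ratio of $U$ is $\pi(U)/c(U)$. A graph is $B$-proper for $r$ if for every vertex $v$ there is an $r$–$v$ path whose total vertex cost is at most $B$.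
   Formalization: The vertex costs c, the vertex prizes π, the budget B and the parameter ε take values in the rationals, so the prize-to-cost ratio γ is rational as well. -}

module Defs where

open import Data.Nat using (ℕ; suc) renaming (_+_ to _+ℕ_; _<_ to _<ℕ_)
open import Data.Fin using (Fin; toℕ)
open import Data.List using (List; []; _∷_; map; foldr; length)
open import Data.List.Membership.Propositional using (_∈_)
open import Data.List.Relation.Unary.Unique.Propositional using (Unique)
open import Data.List.Relation.Unary.All using (All)
open import Data.Product using (_×_; _,_; Σ)
open import Data.Sum using (_⊎_)
open import Data.Empty using (⊥)
open import Data.Rational using (ℚ; 0ℚ; _+_; _÷_; _≟_; _≤_; ≢-nonZero)
open import Relation.Nullary using (yes; no)
open import Relation.Binary.PropositionalEquality using (_≡_)

record Graph (n : ℕ) : Set₁ where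
  field
    Adj    : Fin n → Fin n → Set
    sym    : ∀ {u v} → Adj u v → Adj v u
    irrefl : ∀ {u} → Adj u u → ⊥
open Graph public

data Walk {A : Set} (R : A → A → Set) : A → A → List A → Set where
  single : ∀ {x} → Walk R x x (x ∷ [])
  step   : ∀ {x y z vs} → R x y → Walk R y z vs → Walk R x z (x ∷ vs)

Path : ∀ {n} → Graph n → Fin n → Fin n → List (Fin n) → Set
Path G x y vs = Walk (Adj G) x y vs × Unique vs

Σℚ : List ℚ → ℚ
Σℚ = foldr _+_ 0ℚ

cost : ∀ {n} → (Fin n → ℚ) → List (Fin n) → ℚ
cost c vs = Σℚ (map c vs)

-- Prize-to-cost ratio p / q  (set to 0 when q = 0; only used when q > 0).
ratio : ℚ → ℚ → ℚ
ratio p q with q ≟ 0ℚ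
... | yes _  = 0ℚ
... | no q≢0 = _÷_ p q {{≢-nonZero q≢0}}

Proper : ∀ {n} → Graph n → (Fin n → ℚ) → Fin n → ℚ → Set
Proper {n} G c r B =
  ∀ v → Σ (List (Fin n)) λ vs → Path G r v vs × cost c vs ≤ B

EdgeAdj : ∀ {n} → List (Fin n × Fin n) → Fin n → Fin n → Set
EdgeAdj F u v = ((u , v) ∈ F) ⊎ ((v , u) ∈ F)

-- Each edge {u,v} is stored once, as (u , v) with toℕ u < toℕ v.
record Tree {n : ℕ} (G : Graph n) : Set where
  field
    verts       : List (Fin n)
    verts-uniq  : Unique verts
    edges       : List (Fin n × Fin n)
    edges-uniq  : Unique edges
    edges-valid : All (λ e → (Data.Product.proj₁ e ∈ verts) ×
                             (Data.Product.proj₂ e ∈ verts) ×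
                             Adj G (Data.Product.proj₁ e) (Data.Product.proj₂ e) ×
                             (toℕ (Data.Product.proj₁ e) <ℕ toℕ (Data.Product.proj₂ e)))
                      edges
    edge-count  : length edges +ℕ 1 ≡ length verts
    connected   : ∀ {u v} → u ∈ verts → v ∈ verts →
                  Σ (List (Fin n)) λ ws → Walk (EdgeAdj edges) u v ws
open Tree public

module Submission where

-- Root a spanning tree of T at r and cut it bottom-up into pieces: each piece consists of
-- subtrees below a common anchor vertex (possibly with the anchor itself), costs at least
-- h = εB/2, and is covered by a cheapest r–anchor path (cost at most B, by properness) plus
-- vertices of cost at most 2h, hence by a tree through r of cost at most B + 2h = (1 + ε)B.
-- The remainder at the root costs less than h and is merged into a piece attached to it.
-- These parts partition T, so by averaging one of them has prize at least γ times its cost,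
-- hence at least γh; its tree costs at most 2B, so its prize-to-cost ratio is at least εγ/4.

open import Defs renaming (sym to Adj-sym)
open import Data.Nat using (ℕ; suc) renaming (_<_ to _<ℕ_)
open import Data.Fin using (Fin; toℕ) renaming (_≟_ to _≟ᶠ_)
open import Data.Fin.Properties using () renaming (<-cmp to <-cmpᶠ)
open import Data.Integer using (+_)
open import Data.List using (List; []; _∷_; _++_; [_]; map; concatMap)
open import Data.List.Properties using (++-assoc; ++-identityʳ; concatMap-++; concatMap-map)
open import Data.List.Membership.Propositional using (_∈_; _∉_; find)
open import Data.List.Membership.Propositional.Properties using (∈-∃++; ∈-++⁻)
open import Data.List.Relation.Unary.Any as Any using (Any; here; there; any?)
open import Data.List.Relation.Unary.All as All using (All; []; _∷_)
import Data.List.Relation.Unary.Any.Properties as AnyP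
open import Data.List.Relation.Unary.All.Properties using (¬Any⇒All¬; ++⁻ˡ)
open import Data.List.Relation.Unary.AllPairs using ([]; _∷_)
open import Data.List.Relation.Unary.Unique.Propositional using (Unique)
open import Data.List.Relation.Unary.Unique.Propositional.Properties using (Unique[x∷xs]⇒x∉xs)
open import Data.List.Relation.Binary.Subset.Propositional using (_⊆_)
open import Data.List.Relation.Binary.Subset.Propositional.Properties
  using (⊆-refl; ⊆-trans; ⊆-respʳ-↭; xs⊆x∷xs; ∷⁺ʳ; ∈-∷⁺ʳ; ⊆∷∧∉⇒⊆;
         xs⊆xs++ys; xs⊆ys++xs)
open import Data.List.Relation.Binary.Permutation.Propositional
  using (_↭_; ↭-refl; ↭-sym; ↭-trans; ↭-reflexive; ↭-prep; ↭-swap; ↭⇒↭ₛ; module PermutationReasoning)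
import Data.List.Relation.Binary.Permutation.Propositional.Properties as ↭
import Data.List.Relation.Binary.Permutation.Setoid.Properties as ↭ₛ
open import Data.Product using (_×_; _,_; Σ; Σ-syntax; proj₁; proj₂)
import Data.Sum as Sum
open Sum using (_⊎_; inj₁; inj₂)
open import Data.Unit using (⊤; tt)
open import Data.Empty using (⊥-elim)
open import Function using (id; _∘_)
open import Relation.Nullary using (¬_; yes; no)
open import Relation.Binary.Definitions using (tri<; tri≈; tri>)
open import Relation.Binary.PropositionalEquality
  using (_≡_; refl; sym; trans; cong; subst; subst₂; setoid)
open import Data.Rational
  using (ℚ; 0ℚ; 1ℚ; ½; _+_; _*_; _/_; _≤_; _<_; _≤?_; ≢-nonZero; positive; nonNegative)
  renaming (_≟_ to _≟ℚ_)
open import Data.Rational.Properties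
open import Data.Rational.Solver using (module +-*-Solver)

private
  variable
    A I : Set
    R S : A → A → Set
    x y z : A
    ws : List A

Σℚ-map-++ : (f : A → ℚ) (xs ys : List A) →
            Σℚ (map f (xs ++ ys)) ≡ Σℚ (map f xs) + Σℚ (map f ys)
Σℚ-map-++ f []       ys = sym (+-identityˡ _)
Σℚ-map-++ f (x ∷ xs) ys = trans (cong (_+_ (f x)) (Σℚ-map-++ f xs ys)) (sym (+-assoc (f x) _ _))

Σℚ-map-↭ : (f : A → ℚ) {xs ys : List A} → xs ↭ ys → Σℚ (map f xs) ≡ Σℚ (map f ys)
Σℚ-map-↭ f xs↭ys =
  ↭ₛ.foldr-commMonoid (setoid ℚ) +-0-isCommutativeMonoid (↭⇒↭ₛ (↭.map⁺ f xs↭ys))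

Σℚ-map-nonNeg : {f : A → ℚ} → (∀ a → 0ℚ ≤ f a) → ∀ xs → 0ℚ ≤ Σℚ (map f xs)
Σℚ-map-nonNeg f≥0 []       = ≤-refl
Σℚ-map-nonNeg f≥0 (x ∷ xs) = +-mono-≤ (f≥0 x) (Σℚ-map-nonNeg f≥0 xs)

Σℚ-map-mono-⊆ : {f : A → ℚ} → (∀ a → 0ℚ ≤ f a) → {xs ys : List A} →
                Unique xs → xs ⊆ ys → Σℚ (map f xs) ≤ Σℚ (map f ys)
Σℚ-map-mono-⊆ f≥0 {[]}     {ys} _ _ = Σℚ-map-nonNeg f≥0 ys
Σℚ-map-mono-⊆ {f = f} f≥0 {x ∷ xs} u@(_ ∷ uxs) xs⊆ys
  with ys₁ , ys₂ , refl ← ∈-∃++ (xs⊆ys (here refl)) = begin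
    f x + Σℚ (map f xs)         ≤⟨ +-monoʳ-≤ (f x) (Σℚ-map-mono-⊆ f≥0 uxs xs⊆ys₁₂) ⟩
    f x + Σℚ (map f (ys₁ ++ ys₂)) ≡⟨ Σℚ-map-↭ f (shift-x) ⟨
    Σℚ (map f (ys₁ ++ x ∷ ys₂)) ∎
  where
  open ≤-Reasoning
  shift-x = ↭.shift x ys₁ ys₂
  xs⊆ys₁₂ : xs ⊆ ys₁ ++ ys₂
  xs⊆ys₁₂ = ⊆∷∧∉⇒⊆ (⊆-respʳ-↭ shift-x (xs⊆ys ∘ there)) (Unique[x∷xs]⇒x∉xs u)

p≤p+q : ∀ {p q} → 0ℚ ≤ q → p ≤ p + q
p≤p+q {p} {q} q≥0 = subst (_≤ p + q) (+-identityʳ p) (+-monoʳ-≤ p q≥0)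

p≤q+p : ∀ {p q} → 0ℚ ≤ q → p ≤ q + p
p≤q+p {p} {q} q≥0 = subst (_≤ q + p) (+-identityˡ p) (+-monoˡ-≤ p q≥0)

Unique-++⁻ˡ : ∀ (xs : List A) {ys} → Unique (xs ++ ys) → Unique xs
Unique-++⁻ˡ []       _          = []
Unique-++⁻ˡ (x ∷ xs) (x∉ ∷ u) = ++⁻ˡ xs x∉ ∷ Unique-++⁻ˡ xs u

Unique-++⁻ʳ : ∀ (xs : List A) {ys} → Unique (xs ++ ys) → Unique ys
Unique-++⁻ʳ []       u       = u
Unique-++⁻ʳ (x ∷ xs) (_ ∷ u) = Unique-++⁻ʳ xs u

Unique-concatMap⁻ : (f : I → List A) {is : List I} {i : I} →
                    Unique (concatMap f is) → i ∈ is → Unique (f i)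
Unique-concatMap⁻ f {j ∷ _} u (here refl) = Unique-++⁻ˡ (f j) u
Unique-concatMap⁻ f {j ∷ _} u (there i∈) = Unique-concatMap⁻ f (Unique-++⁻ʳ (f j) u) i∈

Unique-resp-↭ : {xs ys : List A} → xs ↭ ys → Unique xs → Unique ys
Unique-resp-↭ {A} xs↭ys = ↭ₛ.Unique-resp-↭ (setoid A) (↭⇒↭ₛ xs↭ys)

module _ (X : I → List A) (f g : A → ℚ) (k : ℚ) where

  private
    F G : List I → ℚ
    F is = Σℚ (map f (concatMap X is))
    G is = Σℚ (map g (concatMap X is))

    F₁ G₁ : I → ℚ
    F₁ i = Σℚ (map f (X i))
    G₁ i = Σℚ (map g (X i))

    Sparse : I → Set
    Sparse i = F₁ i < k * G₁ i

    sparse-≤ : ∀ is → All Sparse is → F is ≤ k * G is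
    sparse-≤ []       []         = ≤-reflexive (sym (*-zeroʳ k))
    sparse-≤ (i ∷ is) (i< ∷ is<) =
      subst₂ _≤_ (sym (Σℚ-map-++ f (X i) _))
                 (sym (trans (cong (k *_) (Σℚ-map-++ g (X i) _)) (*-distribˡ-+ k _ _)))
                 (+-mono-≤ (<⇒≤ i<) (sparse-≤ is is<))

    sparse-< : ∀ i is → All Sparse (i ∷ is) → F (i ∷ is) < k * G (i ∷ is)
    sparse-< i is (i< ∷ is<) =
      subst₂ _<_ (sym (Σℚ-map-++ f (X i) _))
                 (sym (trans (cong (k *_) (Σℚ-map-++ g (X i) _)) (*-distribˡ-+ k _ _)))
                 (+-mono-<-≤ i< (sparse-≤ is is<))

  averaging : ∀ i is →
              k * Σℚ (map g (concatMap X (i ∷ is))) ≤ Σℚ (map f (concatMap X (i ∷ is))) →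
              Any (λ j → k * Σℚ (map g (X j)) ≤ Σℚ (map f (X j))) (i ∷ is)
  averaging i is dense with any? (λ j → k * G₁ j ≤? F₁ j) (i ∷ is)
  ... | yes found = found
  ... | no none   = ⊥-elim (<-irrefl refl (≤-<-trans dense
                      (sparse-< i is (All.map ≰⇒> (¬Any⇒All¬ (i ∷ is) none)))))

↭-interchange : (as bs cs ds : List A) → (as ++ bs) ++ (cs ++ ds) ↭ (as ++ cs) ++ (bs ++ ds)
↭-interchange as bs cs ds = begin
  (as ++ bs) ++ (cs ++ ds) ≡⟨ ++-assoc as bs _ ⟩
  as ++ bs ++ cs ++ ds     ↭⟨ ↭.++⁺ˡ as (↭.shifts bs cs) ⟩
  as ++ cs ++ bs ++ ds     ≡⟨ ++-assoc as cs _ ⟨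
  (as ++ cs) ++ (bs ++ ds) ∎
  where open PermutationReasoning

↭-extract : (as xs bs ys : List A) → (as ++ xs ++ bs) ++ ys ↭ (ys ++ xs) ++ (as ++ bs)
↭-extract as xs bs ys = begin
  (as ++ xs ++ bs) ++ ys ↭⟨ ↭.++-comm _ ys ⟩
  ys ++ as ++ xs ++ bs   ↭⟨ ↭.++⁺ˡ ys (↭.shifts as xs) ⟩
  ys ++ xs ++ as ++ bs   ≡⟨ ++-assoc ys xs _ ⟨
  (ys ++ xs) ++ (as ++ bs) ∎
  where open PermutationReasoning

↭-rotate : (xs ys : List A) → xs ++ ys ↭ (ys ++ xs) ++ []
↭-rotate xs ys = ↭-trans (↭.++-comm xs ys) (↭-reflexive (sym (++-identityʳ _)))

Walk-map : (∀ {a b} → R a b → S a b) → Walk R x y ws → Walk S x y ws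
Walk-map f single     = single
Walk-map f (step r w) = step (f r) (Walk-map f w)

Walk-snoc : Walk R x y ws → R y z → Walk R x z (ws ++ [ z ])
Walk-snoc single     r  = step r single
Walk-snoc (step r w) r′ = step r (Walk-snoc w r′)

Walk-source∈ : Walk R x y ws → x ∈ ws
Walk-source∈ single     = here refl
Walk-source∈ (step _ _) = here refl

Walk-target∈ : Walk R x y ws → y ∈ ws
Walk-target∈ single     = here refl
Walk-target∈ (step _ w) = there (Walk-target∈ w)

module _ {n : ℕ} (G : Graph n) where

  private
    V = Fin n

  open import Data.List.Membership.DecPropositional (_≟ᶠ_ {n}) using (_∈?_)

  singletonTree : V → Tree G
  singletonTree r = record
    { verts = [ r ] ; verts-uniq = [] ∷ [] ; edges = [] ; edges-uniq = []
    ; edges-valid = [] ; edge-count = refl ; connected = λ { (here refl) (here refl) → _ , single } }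

  data Orientation (x y : V) : V × V → Set where
    forward  : Orientation x y (x , y)
    backward : Orientation x y (y , x)

  orient : ∀ {x y} → Adj G x y →
           Σ[ e ∈ V × V ] Orientation x y e × Adj G (proj₁ e) (proj₂ e) × toℕ (proj₁ e) <ℕ toℕ (proj₂ e)
  orient {x} {y} xy with <-cmpᶠ x y
  ... | tri< x<y _ _    = (x , y) , forward , xy , x<y
  ... | tri≈ _ refl _   = ⊥-elim (irrefl G xy)
  ... | tri> _ _ y<x    = (y , x) , backward , Adj-sym G xy , y<x

  extend : (Q : Tree G) {x y : V} → x ∈ verts Q → y ∉ verts Q → Adj G x y → Tree G
  extend Q {x} {y} x∈Q y∉Q xy = record
    { verts       = y ∷ verts Q
    ; verts-uniq  = ¬Any⇒All¬ _ y∉Q ∷ verts-uniq Q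
    ; edges       = e ∷ edges Q
    ; edges-uniq  = All.map (fresh o) (edges-valid Q) ∷ edges-uniq Q
    ; edges-valid = endpoints o valid ∷ All.map (λ (u∈ , v∈ , uv) → there u∈ , there v∈ , uv) (edges-valid Q)
    ; edge-count  = cong suc (edge-count Q)
    ; connected   = connected′
    }
    where
    e     = proj₁ (orient xy)
    o     = proj₁ (proj₂ (orient xy))
    valid = proj₂ (proj₂ (orient xy))

    fresh : ∀ {e e′ : V × V} → Orientation x y e →
            (proj₁ e′ ∈ verts Q) × (proj₂ e′ ∈ verts Q) × Adj G (proj₁ e′) (proj₂ e′) × _ →
            ¬ (e ≡ e′)
    fresh forward  (_  , v∈ , _) refl = y∉Q v∈
    fresh backward (u∈ , _  , _) refl = y∉Q u∈

    endpoints : ∀ {e} {P : Set} → Orientation x y e → P →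
                (proj₁ e ∈ y ∷ verts Q) × (proj₂ e ∈ y ∷ verts Q) × P
    endpoints forward  p = there x∈Q , here refl , p
    endpoints backward p = here refl , there x∈Q , p

    x→y : ∀ {e} → Orientation x y e → EdgeAdj (e ∷ edges Q) x y
    x→y forward  = inj₁ (here refl)
    x→y backward = inj₂ (here refl)

    y→x : ∀ {e} → Orientation x y e → EdgeAdj (e ∷ edges Q) y x
    y→x forward  = inj₂ (here refl)
    y→x backward = inj₁ (here refl)

    old : ∀ {u v} → u ∈ verts Q → v ∈ verts Q → Σ[ ws ∈ List V ] Walk (EdgeAdj (e ∷ edges Q)) u v ws
    old u∈ v∈ = _ , Walk-map (Sum.map there there) (proj₂ (connected Q u∈ v∈))

    connected′ : ∀ {u v} → u ∈ y ∷ verts Q → v ∈ y ∷ verts Q →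
                 Σ[ ws ∈ List V ] Walk (EdgeAdj (e ∷ edges Q)) u v ws
    connected′ (here refl) (here refl) = _ , single
    connected′ (here refl) (there v∈)  = _ , step (y→x o) (proj₂ (old x∈Q v∈))
    connected′ (there u∈)  (here refl) = _ , Walk-snoc (proj₂ (old u∈ x∈Q)) (x→y o)
    connected′ (there u∈)  (there v∈)  = old u∈ v∈

  Near : List V → V → Set
  Near U x = x ∈ U ⊎ Σ[ u ∈ V ] (u ∈ U × Adj G u x)

  Attached : List V → List V → Set
  Attached U []      = ⊤
  Attached U (x ∷ L) = Near U x × Attached (x ∷ U) L

  Near-mono : ∀ {U W x} → U ⊆ W → Near U x → Near W x
  Near-mono U⊆W (inj₁ x∈)             = inj₁ (U⊆W x∈)
  Near-mono U⊆W (inj₂ (u , u∈ , ux)) = inj₂ (u , U⊆W u∈ , ux)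

  Attached-mono : ∀ {U W} L → U ⊆ W → Attached U L → Attached W L
  Attached-mono []      U⊆W _          = tt
  Attached-mono (x ∷ L) U⊆W (x≈ , L≈) = Near-mono U⊆W x≈ , Attached-mono L (∷⁺ʳ x U⊆W) L≈

  Attached-++ : ∀ {U W} L {M} → Attached U L → Attached W M → W ⊆ L ++ U → Attached U (L ++ M)
  Attached-++ []      _          M≈ W⊆U = Attached-mono _ W⊆U M≈
  Attached-++ {U} (x ∷ L) (x≈ , L≈) M≈ W⊆ =
    x≈ , Attached-++ L L≈ M≈ (⊆-respʳ-↭ (↭-sym (↭.shift x L U)) W⊆)

  Attached-child : ∀ {p v} L → Adj G p v → Attached [ v ] L → Attached [ p ] (v ∷ L)
  Attached-child {p} L pv L≈ = inj₂ (p , here refl , pv) , Attached-mono L (∷⁺ʳ _ (λ ())) L≈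

  Walk-attached : ∀ {U x y vs} → Walk (Adj G) x y vs → Near U x → Attached U vs
  Walk-attached single     x≈ = x≈ , tt
  Walk-attached (step xy w) x≈ = x≈ , Walk-attached w (inj₂ (_ , here refl , xy))

  grow : (Q : Tree G) (L : List V) → Attached (verts Q) L →
         Σ[ Q′ ∈ Tree G ] (verts Q ⊆ verts Q′ × L ⊆ verts Q′ × verts Q′ ⊆ L ++ verts Q)
  grow Q []      _          = Q , id , (λ ()) , id
  grow Q (x ∷ L) (x≈ , L≈) with x ∈? verts Q
  ... | yes x∈Q =
    let Q′ , Q⊆ , L⊆ , ⊆LQ = grow Q L (Attached-mono L (∈-∷⁺ʳ x∈Q ⊆-refl) L≈)
    in Q′ , Q⊆ , ∈-∷⁺ʳ (Q⊆ x∈Q) L⊆ , there ∘ ⊆LQ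
  ... | no x∉Q with x≈
  ...   | inj₁ x∈Q            = ⊥-elim (x∉Q x∈Q)
  ...   | inj₂ (u , u∈Q , ux) =
    let Q′ , Q₁⊆ , L⊆ , ⊆LQ = grow (extend Q u∈Q x∉Q ux) L L≈
    in Q′ , Q₁⊆ ∘ there , ∈-∷⁺ʳ (Q₁⊆ (here refl)) L⊆ , ⊆-respʳ-↭ (↭.shift x L (verts Q)) ⊆LQ

  spanningTree : ∀ {r L} → r ∈ L → Attached [ r ] L →
                 Σ[ Q ∈ Tree G ] (r ∈ verts Q × L ⊆ verts Q × verts Q ⊆ L)
  spanningTree {r} {L} r∈L L≈ =
    let Q , r⊆ , L⊆ , ⊆Lr = grow (singletonTree r) L L≈
    in Q , r⊆ (here refl) , L⊆ , ⊆L ∘ ⊆Lr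
    where
    ⊆L : L ++ [ r ] ⊆ L
    ⊆L v∈ with ∈-++⁻ L v∈
    ... | inj₁ v∈L         = v∈L
    ... | inj₂ (here refl) = r∈L

  data Rose : Set where
    node : V → List Rose → Rose

  flat : Rose → List V
  flats : List Rose → List V
  flat (node v ts) = v ∷ flats ts
  flats []       = []
  flats (t ∷ ts) = flat t ++ flats ts

  data Hangs (p : V) : Rose → Set where
    hangs : ∀ {v ts} → Adj G p v → All (Hangs v) ts → Hangs p (node v ts)

  graftAt : V → V → V → List Rose → List Rose
  graftInto : V → V → List Rose → List Rose

  graftAt x y v ts with v ≟ᶠ x
  ... | yes _ = node y [] ∷ ts
  ... | no _  = graftInto x y ts

  graftInto x y []              = []
  graftInto x y (node v ts ∷ us) with x ∈? v ∷ flats ts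
  ... | yes _ = node v (graftAt x y v ts) ∷ us
  ... | no _  = node v ts ∷ graftInto x y us

  graftAt-↭ : ∀ {x y v} ts → x ∈ v ∷ flats ts → v ∷ flats (graftAt x y v ts) ↭ y ∷ v ∷ flats ts
  graftInto-↭ : ∀ {x y} us → x ∈ flats us → flats (graftInto x y us) ↭ y ∷ flats us

  graftAt-↭ {x} {y} {v} ts x∈ with v ≟ᶠ x
  ... | yes _ = ↭-swap v y ↭-refl
  ... | no v≢x with x∈
  ...   | here x≡v = ⊥-elim (v≢x (sym x≡v))
  ...   | there x∈ts = ↭-trans (↭-prep v (graftInto-↭ ts x∈ts)) (↭-swap v y ↭-refl)

  graftInto-↭ {x} {y} (node v ts ∷ us) x∈ with x ∈? v ∷ flats ts
  ... | yes x∈t = ↭.++⁺ʳ (flats us) (graftAt-↭ ts x∈t)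
  ... | no x∉t with ∈-++⁻ (v ∷ flats ts) x∈
  ...   | inj₁ x∈t  = ⊥-elim (x∉t x∈t)
  ...   | inj₂ x∈us = ↭-trans (↭.++⁺ˡ (v ∷ flats ts) (graftInto-↭ us x∈us))
                                (↭.shift y (v ∷ flats ts) (flats us))

  graftAt-hangs : ∀ {x y v} ts → Adj G x y → All (Hangs v) ts → All (Hangs v) (graftAt x y v ts)
  graftInto-hangs : ∀ {x y p} us → Adj G x y → All (Hangs p) us → All (Hangs p) (graftInto x y us)

  graftAt-hangs {x} {y} {v} ts xy hs with v ≟ᶠ x
  ... | yes refl = hangs xy [] ∷ hs
  ... | no _     = graftInto-hangs ts xy hs

  graftInto-hangs []               xy []                  = []
  graftInto-hangs {x} (node v ts ∷ us) xy (hangs pv hs ∷ hus) with x ∈? v ∷ flats ts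
  ... | yes _ = hangs pv (graftAt-hangs ts xy hs) ∷ hus
  ... | no _  = hangs pv hs ∷ graftInto-hangs us xy hus

  module _ (T : Tree G) {r : V} (r∈T : r ∈ verts T) where

    record SubRose : Set where
      field
        children : List Rose
        hanging  : All (Hangs r) children
        unique   : Unique (r ∷ flats children)
        inside   : r ∷ flats children ⊆ verts T

      vertices : List V
      vertices = r ∷ flats children

    open SubRose

    edge-adj : ∀ {x y} → EdgeAdj (edges T) x y → Adj G x y
    edge-adj (inj₁ xy∈) = proj₁ (proj₂ (proj₂ (All.lookup (edges-valid T) xy∈)))
    edge-adj (inj₂ yx∈) = Adj-sym G (proj₁ (proj₂ (proj₂ (All.lookup (edges-valid T) yx∈))))

    edge-target∈ : ∀ {x y} → EdgeAdj (edges T) x y → y ∈ verts T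
    edge-target∈ (inj₁ xy∈) = proj₁ (proj₂ (All.lookup (edges-valid T) xy∈))
    edge-target∈ (inj₂ yx∈) = proj₁ (All.lookup (edges-valid T) yx∈)

    sprout : (s : SubRose) {x y : V} → x ∈ vertices s → Adj G x y → y ∈ verts T →
             Σ[ s′ ∈ SubRose ] (vertices s ⊆ vertices s′ × y ∈ vertices s′)
    sprout s {x} {y} x∈ xy y∈T with y ∈? vertices s
    ... | yes y∈ = s , id , y∈
    ... | no y∉  = s′ , ↭.∈-resp-↭ (↭-sym grafted) ∘ there , ↭.∈-resp-↭ (↭-sym grafted) (here refl)
      where
      grafted = graftAt-↭ (children s) x∈
      s′ : SubRose
      s′ = record
        { children = graftAt x y r (children s)
        ; hanging  = graftAt-hangs (children s) xy (hanging s)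
        ; unique   = Unique-resp-↭ (↭-sym grafted) (¬Any⇒All¬ _ y∉ ∷ unique s)
        ; inside   = ∈-∷⁺ʳ y∈T (inside s) ∘ ↭.∈-resp-↭ grafted
        }

    sproutWalk : (s : SubRose) {x z : V} {ws : List V} → x ∈ vertices s → Walk (EdgeAdj (edges T)) x z ws →
                 Σ[ s′ ∈ SubRose ] (vertices s ⊆ vertices s′ × z ∈ vertices s′)
    sproutWalk s x∈ single = s , id , x∈
    sproutWalk s x∈ (step e w) =
      let s₁ , s⊆s₁ , y∈s₁ = sprout s x∈ (edge-adj e) (edge-target∈ e)
          s₂ , s₁⊆s₂ , z∈s₂ = sproutWalk s₁ y∈s₁ w
      in s₂ , s₁⊆s₂ ∘ s⊆s₁ , z∈s₂

    coverBy : (L : List V) → L ⊆ verts T → Σ[ s ∈ SubRose ] (L ⊆ vertices s)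
    coverBy []      _    = root , λ ()
      where
      root : SubRose
      root = record { children = [] ; hanging = [] ; unique = [] ∷ [] ; inside = ∈-∷⁺ʳ r∈T (λ ()) }
    coverBy (v ∷ L) v∷L⊆T =
      let s , L⊆s = coverBy L (v∷L⊆T ∘ there)
          s′ , s⊆s′ , v∈s′ = sproutWalk s (here refl) (proj₂ (connected T r∈T (v∷L⊆T (here refl))))
      in s′ , ∈-∷⁺ʳ v∈s′ (s⊆s′ ∘ L⊆s)

    spanningRose : Σ[ s ∈ SubRose ] (verts T ⊆ vertices s)
    spanningRose = coverBy (verts T) id

  Proper⇒cost≤ : ∀ {c : V → ℚ} {r B} → (∀ v → 0ℚ ≤ c v) → Proper G c r B → ∀ v → c v ≤ B
  Proper⇒cost≤ {c} c≥0 proper v =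
    let vs , (w , _) , vs≤B = proper v
    in ≤-trans (≤-reflexive (sym (+-identityʳ (c v))))
               (≤-trans (Σℚ-map-mono-⊆ c≥0 ([] ∷ []) (∈-∷⁺ʳ (Walk-target∈ w) (λ ()))) vs≤B)

  module Decomposition (c : V → ℚ) (c≥0 : ∀ v → 0ℚ ≤ c v) {B h : ℚ}
                       (h>0 : 0ℚ < h) (h≤B : h ≤ B) (c≤B : ∀ v → c v ≤ B) where

    private
      C : List V → ℚ
      C = cost c

      h≤h+h : h ≤ h + h
      h≤h+h = p≤p+q (<⇒≤ h>0)

    -- The bound B + h on the body leaves room to merge a root remainder of cost below h into it.
    record Piece : Set where
      field
        anchor         : V
        body           : List V
        reach          : List V
        reach-attached : Attached [ anchor ] reach
        body⊆          : body ⊆ anchor ∷ reach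
        reach-cheap    : C reach ≤ h + h
        body-heavy     : h ≤ C body
        body-bounded   : C body ≤ B + h

    open Piece public

    Bodies : List Piece → List V
    Bodies = concatMap body

    Hook : List V → List Piece → Set
    Hook W ps = ps ≡ [] ⊎ Any (λ P → Attached W (body P)) ps

    Hook-mono : ∀ {W W′} ps → W ⊆ W′ → Hook W ps → Hook W′ ps
    Hook-mono ps W⊆W′ (inj₁ ps≡[]) = inj₁ ps≡[]
    Hook-mono ps W⊆W′ (inj₂ any)   = inj₂ (Any.map (Attached-mono _ W⊆W′) any)

    Hook-++ : ∀ {W₁ W₂ W} ps₁ ps₂ → W₁ ⊆ W → W₂ ⊆ W →
              Hook W₁ ps₁ → Hook W₂ ps₂ → Hook W (ps₁ ++ ps₂)
    Hook-++ ps₁ ps₂ W₁⊆W W₂⊆W (inj₂ any₁) _ =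
      inj₂ (AnyP.++⁺ˡ (Any.map (Attached-mono _ W₁⊆W) any₁))
    Hook-++ []  ps₂ W₁⊆W W₂⊆W (inj₁ refl) hook₂ = Hook-mono ps₂ W₂⊆W hook₂

    -- The hook is a piece attachable to p and the rest: at the root, this is where a
    -- rest too cheap to be a piece of its own gets merged.
    record Split (p : V) (U : List V) : Set where
      field
        pieces        : List Piece
        rest          : List V
        rest-attached : Attached [ p ] rest
        partition     : U ↭ Bodies pieces ++ rest
        hook          : Hook (p ∷ rest) pieces

    open Split public

    Cheap : ∀ {p U} → Split p U → Set
    Cheap s = C (rest s) < h

    emptySplit : ∀ {p} → Split p []
    emptySplit = record
      { pieces = [] ; rest = [] ; rest-attached = tt ; partition = ↭-refl ; hook = inj₁ refl }

    split-++ : ∀ {p U W} → Split p U → Split p W → Split p (U ++ W)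
    split-++ {p} s₁ s₂ = record
      { pieces        = pieces s₁ ++ pieces s₂
      ; rest          = rest s₁ ++ rest s₂
      ; rest-attached = Attached-++ (rest s₁) (rest-attached s₁) (rest-attached s₂) (xs⊆ys++xs _ _)
      ; partition     = ↭-trans (↭.++⁺ (partition s₁) (partition s₂))
                          (↭-trans (↭-interchange (Bodies (pieces s₁)) (rest s₁) (Bodies (pieces s₂)) (rest s₂))
                                   (↭-reflexive (cong (_++ _) (sym (concatMap-++ body (pieces s₁) (pieces s₂))))))
      ; hook          = Hook-++ (pieces s₁) (pieces s₂) (∷⁺ʳ p (xs⊆xs++ys _ _)) (∷⁺ʳ p (xs⊆ys++xs _ _))
                                (hook s₁) (hook s₂)
      }

    split-∷ : ∀ {p v U} → Adj G p v → Split v U → Split p (v ∷ U)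
    split-∷ {p} {v} pv s = record
      { pieces        = pieces s
      ; rest          = v ∷ rest s
      ; rest-attached = Attached-child (rest s) pv (rest-attached s)
      ; partition     = ↭-trans (↭-prep v (partition s)) (↭-sym (↭.shift v (Bodies (pieces s)) (rest s)))
      ; hook          = Hook-mono (pieces s) (xs⊆x∷xs _ p) (hook s)
      }

    cutRest : ∀ {p U} (s : Split p U) → h ≤ C (rest s) → C (rest s) ≤ h + h → Split p U
    cutRest {p} s heavy cheap = record
      { pieces        = piece ∷ pieces s
      ; rest          = []
      ; rest-attached = tt
      ; partition     = ↭-trans (partition s) (↭-rotate (Bodies (pieces s)) (rest s))
      ; hook          = inj₂ (here (rest-attached s))
      }
      where
      piece : Piece
      piece = record
        { anchor = p ; body = rest s ; reach = rest s ; reach-attached = rest-attached s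
        ; body⊆ = xs⊆x∷xs _ p ; reach-cheap = cheap ; body-heavy = heavy
        ; body-bounded = ≤-trans cheap (+-monoˡ-≤ h h≤B) }

    cutNode : ∀ {p v U} → Adj G p v → (s : Split v U) → Cheap s → h ≤ c v + C (rest s) → Split p (v ∷ U)
    cutNode {p} {v} pv s cheap heavy = record
      { pieces        = piece ∷ pieces s
      ; rest          = []
      ; rest-attached = tt
      ; partition     = ↭-prep v (↭-trans (partition s) (↭-rotate (Bodies (pieces s)) (rest s)))
      ; hook          = inj₂ (here (Attached-child (rest s) pv (rest-attached s)))
      }
      where
      piece : Piece
      piece = record
        { anchor = v ; body = v ∷ rest s ; reach = rest s ; reach-attached = rest-attached s
        ; body⊆ = id ; reach-cheap = ≤-trans (<⇒≤ cheap) h≤h+h ; body-heavy = heavy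
        ; body-bounded = +-mono-≤ (c≤B v) (<⇒≤ cheap) }

    split : ∀ {p} t → Hangs p t → Σ (Split p (flat t)) Cheap
    splitAll : ∀ {p} ts → All (Hangs p) ts → Σ (Split p (flats ts)) Cheap

    split (node v ts) (hangs pv hs) with splitAll ts hs
    ... | s , cheap with h ≤? c v + C (rest s)
    ...   | yes heavy = cutNode pv s cheap heavy , h>0
    ...   | no light  = split-∷ pv s , ≰⇒> light

    splitAll []       []         = emptySplit , h>0
    splitAll (t ∷ ts) (ht ∷ hts) with split t ht | splitAll ts hts
    ... | s₁ , cheap₁ | s₂ , cheap₂ with h ≤? C (rest s₁ ++ rest s₂)
    ...   | yes heavy = cutRest (split-++ s₁ s₂) heavy bounded , h>0
      where
      bounded : C (rest s₁ ++ rest s₂) ≤ h + h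
      bounded = subst (_≤ h + h) (sym (Σℚ-map-++ c (rest s₁) (rest s₂))) (<⇒≤ (+-mono-< cheap₁ cheap₂))
    ...   | no light  = split-++ s₁ s₂ , ≰⇒> light

  module Parts (c : V → ℚ) (c≥0 : ∀ v → 0ℚ ≤ c v) {r : V} {B h : ℚ}
               (proper : Proper G c r B) (h>0 : 0ℚ < h) (h≤B : h ≤ B) where

    open Decomposition c c≥0 h>0 h≤B (Proper⇒cost≤ c≥0 proper)

    private
      C : List V → ℚ
      C = cost c

    record Part : Set where
      field
        core          : List V
        span          : List V
        core-heavy    : h ≤ C core
        core⊆span     : core ⊆ span
        root∈span     : r ∈ span
        span-attached : Attached [ r ] span
        span-bounded  : C span ≤ B + (h + h)

    open Part

    pieceToPart : Piece → Part
    pieceToPart P = record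
      { core          = body P
      ; span          = vs ++ reach P
      ; core-heavy    = body-heavy P
      ; core⊆span     = ⊆-trans (body⊆ P) (∈-∷⁺ʳ anchor∈ (xs⊆ys++xs _ _))
      ; root∈span     = xs⊆xs++ys _ _ (Walk-source∈ w)
      ; span-attached = Attached-++ vs (Walk-attached w (inj₁ (here refl))) (reach-attached P)
                                    (∈-∷⁺ʳ anchor∈ (λ ()))
      ; span-bounded  = subst (_≤ B + (h + h)) (sym (Σℚ-map-++ c vs (reach P)))
                              (+-mono-≤ vs≤B (reach-cheap P))
      }
      where
      path = proper (anchor P)
      vs   = proj₁ path
      w    = proj₁ (proj₁ (proj₂ path))
      vs≤B = proj₂ (proj₂ path)
      anchor∈ : ∀ {xs} → anchor P ∈ vs ++ xs
      anchor∈ = xs⊆xs++ys _ _ (Walk-target∈ w)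

    cores-pieceToPart : ∀ ps → concatMap core (map pieceToPart ps) ≡ Bodies ps
    cores-pieceToPart = concatMap-map core pieceToPart

    Attached-root : ∀ R → Attached [ r ] R → Attached [ r ] (r ∷ R)
    Attached-root R R≈ = inj₁ (here refl) , Attached-mono R (xs⊆x∷xs _ r) R≈

    rootPart : ∀ R → Attached [ r ] R → h ≤ C (r ∷ R) → C R < h → Part
    rootPart R R≈ heavy cheap = record
      { core = r ∷ R ; span = r ∷ R ; core-heavy = heavy ; core⊆span = id ; root∈span = here refl
      ; span-attached = Attached-root R R≈
      ; span-bounded  = +-mono-≤ (Proper⇒cost≤ c≥0 proper r) (≤-trans (<⇒≤ cheap) (p≤p+q (<⇒≤ h>0)))
      }

    mergedPart : ∀ R → Attached [ r ] R → C (r ∷ R) < h → (P : Piece) → Attached (r ∷ R) (body P) → Part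
    mergedPart R R≈ light P P≈ = record
      { core = (r ∷ R) ++ body P ; span = (r ∷ R) ++ body P
      ; core-heavy    = ≤-trans (body-heavy P)
                                (subst (C (body P) ≤_) (sym C-++) (p≤q+p (Σℚ-map-nonNeg c≥0 (r ∷ R))))
      ; core⊆span     = id
      ; root∈span     = here refl
      ; span-attached = Attached-++ (r ∷ R) (Attached-root R R≈) P≈ (xs⊆xs++ys _ _)
      ; span-bounded  = subst₂ _≤_ (sym C-++) h+[B+h]≡B+[h+h] (<⇒≤ (+-mono-<-≤ light (body-bounded P)))
      }
      where
      C-++ = Σℚ-map-++ c (r ∷ R) (body P)
      h+[B+h]≡B+[h+h] : h + (B + h) ≡ B + (h + h)
      h+[B+h]≡B+[h+h] = trans (sym (+-assoc h B h)) (trans (cong (_+ h) (+-comm h B)) (+-assoc B h h))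

    mergeRoot : ∀ {U} (s : Split r U) → C (r ∷ rest s) < h → h ≤ C (r ∷ U) →
                Σ[ q ∈ Part ] Σ[ qs ∈ List Part ] (r ∷ U ↭ concatMap core (q ∷ qs))
    mergeRoot {U} s light heavy with hook s
    ... | inj₁ none = ⊥-elim (<-irrefl refl (<-≤-trans light (≤-trans heavy (≤-reflexive U≈rest))))
      where
      U≈rest : C (r ∷ U) ≡ C (r ∷ rest s)
      U≈rest = Σℚ-map-↭ c (↭-prep r (↭-trans (partition s)
                                          (↭-reflexive (cong (λ ps → Bodies ps ++ rest s) none))))
    ... | inj₂ any with find any
    ...   | P , P∈ , P≈ with ps₁ , ps₂ , refl ← ∈-∃++ P∈ =
      mergedPart (rest s) (rest-attached s) light P P≈ , map pieceToPart (ps₁ ++ ps₂) , ↭-prep r (begin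
        U
          ↭⟨ partition s ⟩
        Bodies (ps₁ ++ P ∷ ps₂) ++ rest s
          ≡⟨ cong (_++ rest s) (concatMap-++ body ps₁ (P ∷ ps₂)) ⟩
        (Bodies ps₁ ++ body P ++ Bodies ps₂) ++ rest s
          ↭⟨ ↭-extract (Bodies ps₁) (body P) (Bodies ps₂) (rest s) ⟩
        (rest s ++ body P) ++ (Bodies ps₁ ++ Bodies ps₂)
          ≡⟨ cong ((rest s ++ body P) ++_) (trans (sym (concatMap-++ body ps₁ ps₂))
                                                  (sym (cores-pieceToPart (ps₁ ++ ps₂)))) ⟩
        (rest s ++ body P) ++ concatMap core (map pieceToPart (ps₁ ++ ps₂)) ∎)
      where open PermutationReasoning

    cutIntoParts : ∀ ts → All (Hangs r) ts → h ≤ C (r ∷ flats ts) →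
                   Σ[ q ∈ Part ] Σ[ qs ∈ List Part ] (r ∷ flats ts ↭ concatMap core (q ∷ qs))
    cutIntoParts ts hs heavy with splitAll ts hs
    ... | s , cheap with h ≤? C (r ∷ rest s)
    ...   | no light  = mergeRoot s (≰⇒> light) heavy
    ...   | yes rootHeavy =
      rootPart (rest s) (rest-attached s) rootHeavy cheap , map pieceToPart (pieces s) ,
      ↭-prep r (↭-trans (partition s)
                        (↭-trans (↭.++-comm _ (rest s))
                                 (↭-reflexive (cong (rest s ++_) (sym (cores-pieceToPart (pieces s)))))))

    partTree : (q : Part) → Σ[ T* ∈ Tree G ] (r ∈ verts T* × core q ⊆ verts T* × C (verts T*) ≤ B + (h + h))
    partTree q =
      let T* , r∈T* , span⊆T* , T*⊆span = spanningTree (root∈span q) (span-attached q)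
      in T* , r∈T* , span⊆T* ∘ core⊆span q ,
         ≤-trans (Σℚ-map-mono-⊆ c≥0 (verts-uniq T*) T*⊆span) (span-bounded q)

    densePartTree : (π : V → ℚ) → (∀ v → 0ℚ ≤ π v) → {γ : ℚ} → 0ℚ ≤ γ →
                    ∀ ts → All (Hangs r) ts → Unique (r ∷ flats ts) →
                    h ≤ C (r ∷ flats ts) → γ * C (r ∷ flats ts) ≤ cost π (r ∷ flats ts) →
                    Σ[ T* ∈ Tree G ] (r ∈ verts T* × h ≤ C (verts T*) × C (verts T*) ≤ B + (h + h) ×
                                      γ * h ≤ cost π (verts T*))
    densePartTree π π≥0 {γ} γ≥0 ts hs unique heavy dense =
      let q , qs , flat↭cores = cutIntoParts ts hs heavy
          cores-dense = subst₂ (λ x y → γ * x ≤ y) (Σℚ-map-↭ c flat↭cores) (Σℚ-map-↭ π flat↭cores) dense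
          q* , q*∈ , q*-dense = find (averaging core π c γ q qs cores-dense)
          q*-unique = Unique-concatMap⁻ core (Unique-resp-↭ flat↭cores unique) q*∈
          T* , r∈T* , core⊆T* , T*-bounded = partTree q*
      in T* , r∈T* , ≤-trans (core-heavy q*) (Σℚ-map-mono-⊆ c≥0 q*-unique core⊆T*) , T*-bounded ,
         ≤-trans (*-monoˡ-≤-nonNeg γ {{nonNegative γ≥0}} (core-heavy q*))
                 (≤-trans q*-dense (Σℚ-map-mono-⊆ π≥0 q*-unique core⊆T*))

    denseTree : (π : V → ℚ) → (∀ v → 0ℚ ≤ π v) → {γ : ℚ} → 0ℚ ≤ γ →
                (T : Tree G) → r ∈ verts T → h ≤ C (verts T) → γ * C (verts T) ≤ cost π (verts T) →
                Σ[ T* ∈ Tree G ] (r ∈ verts T* × h ≤ C (verts T*) × C (verts T*) ≤ B + (h + h) ×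
                                  γ * h ≤ cost π (verts T*))
    denseTree π π≥0 {γ} γ≥0 T r∈T heavy dense =
      densePartTree π π≥0 γ≥0 (children s) (hanging s) (unique s)
                    (≤-trans heavy (Σℚ-map-mono-⊆ c≥0 (verts-uniq T) T⊆s)) s-dense
      where
      open SubRose
      s   = proj₁ (spanningRose T r∈T)
      T⊆s = proj₂ (spanningRose T r∈T)
      s-dense : γ * C (vertices s) ≤ cost π (vertices s)
      s-dense = begin
        γ * C (vertices s)
          ≤⟨ *-monoˡ-≤-nonNeg γ {{nonNegative γ≥0}} (Σℚ-map-mono-⊆ c≥0 (unique s) (inside s)) ⟩
        γ * C (verts T)         ≤⟨ dense ⟩
        cost π (verts T)        ≤⟨ Σℚ-map-mono-⊆ π≥0 (verts-uniq T) T⊆s ⟩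
        cost π (vertices s)     ∎
        where open ≤-Reasoning

ratio-*-cancel : ∀ {p q} → 0ℚ < q → ratio p q * q ≡ p
ratio-*-cancel {p} {q} q>0 with q ≟ℚ 0ℚ
... | yes refl = ⊥-elim (<-irrefl refl q>0)
... | no q≢0   = trans (*-assoc p _ q) (trans (cong (p *_) (*-inverseˡ q)) (*-identityʳ p))
  where instance _ = ≢-nonZero q≢0

ratio-≥ : ∀ {k p q} → 0ℚ < q → k * q ≤ p → k ≤ ratio p q
ratio-≥ {k} {p} {q} q>0 kq≤p =
  *-cancelʳ-≤-pos q {{positive q>0}} (≤-trans kq≤p (≤-reflexive (sym (ratio-*-cancel q>0))))

module _ (ε B : ℚ) where

  open +-*-Solver

  budget-split : B + ((ε * B) * ½ + (ε * B) * ½) ≡ (1ℚ + ε) * B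
  budget-split = solve 2 (λ e b → b :+ (e :* b :* con ½ :+ e :* b :* con ½) := (con 1ℚ :+ e) :* b) refl ε B

  half-budget-comm : (ε * ½) * B ≡ (ε * B) * ½
  half-budget-comm = solve 2 (λ e b → e :* con ½ :* b := e :* b :* con ½) refl ε B

  module _ (ε>0 : 0ℚ < ε) (B>0 : 0ℚ < B) where

    private
      instance
        _ = positive ε>0
        _ = positive B>0
        _ = pos⇒nonNeg B

    half-budget>0 : 0ℚ < (ε * B) * ½
    half-budget>0 = positive⁻¹ _ {{pos*pos⇒pos (ε * B) {{pos*pos⇒pos ε B}} ½}}

    module _ (ε≤1 : ε ≤ 1ℚ) where

      half-budget≤B : (ε * B) * ½ ≤ B
      half-budget≤B = begin
        (ε * B) * ½                 ≤⟨ p≤p+q (<⇒≤ half-budget>0) ⟩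
        (ε * B) * ½ + (ε * B) * ½   ≡⟨ solve 1 (λ x → x :* con ½ :+ x :* con ½ := x) refl (ε * B) ⟩
        ε * B                       ≤⟨ *-monoʳ-≤-nonNeg B ε≤1 ⟩
        1ℚ * B                      ≡⟨ *-identityˡ B ⟩
        B                           ∎
        where open ≤-Reasoning

      quarter-density : ∀ {γ q} → 0ℚ ≤ γ → q ≤ (1ℚ + ε) * B →
                        ((ε * (+ 1 / 4)) * γ) * q ≤ γ * ((ε * B) * ½)
      quarter-density {γ} {q} γ≥0 q≤ = begin
        k * q              ≤⟨ *-monoˡ-≤-nonNeg k {{k≥0}} (≤-trans q≤ [1+ε]B≤B+B) ⟩
        k * (B + B)        ≡⟨ solve 3 (λ e b g → e :* con (+ 1 / 4) :* g :* (b :+ b) := g :* (e :* b :* con ½))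
                                      refl ε B γ ⟩
        γ * ((ε * B) * ½)  ∎
        where
        open ≤-Reasoning
        k = (ε * (+ 1 / 4)) * γ
        k≥0 = nonNeg*nonNeg⇒nonNeg (ε * (+ 1 / 4)) {{pos⇒nonNeg (ε * (+ 1 / 4)) {{pos*pos⇒pos ε (+ 1 / 4)}}}}
                                   γ {{nonNegative γ≥0}}
        [1+ε]B≤B+B : (1ℚ + ε) * B ≤ B + B
        [1+ε]B≤B+B = begin
          (1ℚ + ε) * B ≡⟨ solve 2 (λ e b → (con 1ℚ :+ e) :* b := b :+ e :* b) refl ε B ⟩
          B + ε * B    ≤⟨ +-monoʳ-≤ B (*-monoʳ-≤-nonNeg B ε≤1) ⟩
          B + 1ℚ * B   ≡⟨ cong (_+_ B) (*-identityˡ B) ⟩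
          B + B        ∎

lemma3 : {n : ℕ} (G : Graph n) (c π : Fin n → ℚ) →
    (∀ v → 0ℚ ≤ c v) → (∀ v → 0ℚ ≤ π v) →
    (r : Fin n) (B : ℚ) → 0ℚ < B → Proper G c r B →
    (ε : ℚ) → 0ℚ < ε → ε ≤ 1ℚ →
    (T : Tree G) → r ∈ verts T →
    (γ : ℚ) → γ ≡ ratio (cost π (verts T)) (cost c (verts T)) →
    (ε * B) * ½ ≤ cost c (verts T) →
    Σ (Tree G) λ T* →
    (r ∈ verts T*) ×
    ((ε * (+ 1 / 4)) * γ ≤ ratio (cost π (verts T*)) (cost c (verts T*))) ×
    ((ε * ½) * B ≤ cost c (verts T*)) ×
    (cost c (verts T*) ≤ (1ℚ + ε) * B)
lemma3 G c π c≥0 π≥0 r B B>0 proper ε ε>0 ε≤1 T r∈T γ refl T-heavy =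
  let T* , r∈T* , T*-heavy , T*-bounded , T*-prize =
        denseTree π π≥0 γ≥0 T r∈T T-heavy (≤-reflexive (ratio-*-cancel cT>0))
      T*-bounded′ = subst (cost c (verts T*) ≤_) (budget-split ε B) T*-bounded
  in T* , r∈T* ,
     ratio-≥ (<-≤-trans h>0 T*-heavy) (≤-trans (quarter-density ε B ε>0 B>0 ε≤1 γ≥0 T*-bounded′) T*-prize) ,
     subst (_≤ cost c (verts T*)) (sym (half-budget-comm ε B)) T*-heavy ,
     T*-bounded′
  where
  h>0  = half-budget>0 ε B ε>0 B>0
  open Parts G c c≥0 proper h>0 (half-budget≤B ε B ε>0 B>0 ε≤1)
  cT>0 = <-≤-trans h>0 T-heavy
  γ≥0  = ratio-≥ cT>0 (≤-trans (≤-reflexive (*-zeroˡ (cost c (verts T)))) (Σℚ-map-nonNeg π≥0 (verts T)))
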